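{- Let $G$ be an abelian group with a direct sum decomposition $G=\mathbb Z\oplus H$, where $\mathbb Z$ denotes an infinite cyclic subgroup and $H<G$ is finite. Let $A\subseteq G$ be finite; for $z\in\mathbb Z$ let $A_z:=A\cap(z+H)$, and let $B:=\{z\in\mathbb Z\colon A_z\ne\emptyset\}$. Assume $\min B=0$, $\max B=l>0$, $0\in A_0$, and $\delta\in A_l$. Let $n:=|B|$, $\sigma:=|A_0|+|A_l|$, $A^*:=A_0\cap(A_l-\delta)$, and $\tau:=|2A|/|A|$. If $\tau<3\big(1-\frac1n\big)$, then $$(3-\tau)(\tau|A|+|A^*|)>3\sigma,\qquad 3|A|-|2A|>\sigma,\qquad |2A|<3|A|-2|A^*|.$$
   Context: $2A=\{a+a'\colon a,a'\in A\}$, $A_l-\delta=\{a-\delta\colon a\in A_l\}$. -}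

module Defs where

open import Data.Nat as ℕ using (ℕ; zero; suc)
open import Data.Integer as ℤ using (ℤ)
import Data.Integer.Properties as ℤP
open import Data.Fin using (Fin)
import Data.Fin.Properties as FinP
open import Data.Product using (_×_; _,_; proj₁; proj₂)
open import Data.Product.Properties using (≡-dec)
open import Data.List using (List; length; map; filter; deduplicate; cartesianProductWith)
open import Relation.Nullary using (Dec)
open import Relation.Binary.PropositionalEquality using (_≡_)
open import Data.Rational as ℚ using (ℚ)

-- The group G = ℤ ⊕ H, where H is a finite abelian group, realised (up to
-- isomorphism) on the carrier Fin m with operation _·_ and inverse inv.
G : ℕ → Set
G m = ℤ × Fin m

_≟G_ : ∀ {m} (x y : G m) → Dec (x ≡ y)
_≟G_ = ≡-dec ℤP._≟_ FinP._≟_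

addG : ∀ {m} → (Fin m → Fin m → Fin m) → G m → G m → G m
addG _·_ (z , h) (z' , h') = (z ℤ.+ z' , h · h')

subG : ∀ {m} → (Fin m → Fin m → Fin m) → (Fin m → Fin m) → G m → G m → G m
subG _·_ inv (z , h) (z' , h') = (z ℤ.- z' , h · inv h')

-- cardinality of the finite set represented by a list (duplicates ignored)
card : ∀ {m} → List (G m) → ℕ
card xs = length (deduplicate _≟G_ xs)

cardℤ : List ℤ → ℕ
cardℤ xs = length (deduplicate ℤP._≟_ xs)

sumset : ∀ {m} → (Fin m → Fin m → Fin m) → List (G m) → List (G m)
sumset _·_ A = cartesianProductWith (addG _·_) A A

fiber : ∀ {m} → List (G m) → ℤ → List (G m)
fiber A z = filter (λ a → proj₁ a ℤP.≟ z) A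

support : ∀ {m} → List (G m) → List ℤ
support A = map proj₁ A

shift : ∀ {m} → (Fin m → Fin m → Fin m) → (Fin m → Fin m) → List (G m) → G m → List (G m)
shift _·_ inv X δ = map (λ x → subG _·_ inv x δ) X

inter : ∀ {m} → List (G m) → List (G m) → List (G m)
inter X Y = filter (λ x → Data.List.Membership.DecPropositional._∈?_ _≟G_ x Y) X
  where import Data.List.Membership.DecPropositional

-- p / q as a rational number (q = 0 gives 0; never used with q = 0 here)
ratio : ℕ → ℕ → ℚ
ratio p zero = ℚ.0ℚ
ratio p (suc q) = ℤ.+ p ℚ./ suc q

nat : ℕ → ℚ
nat p = ℤ.+ p ℚ./ 1

{-# OPTIONS --safe #-}
module Submission where

-- Pick c_z ∈ A_z for every z ∈ B. Then 2A contains A₀ + c_z at height z for each z ∈ B ∖ {l},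
-- c_z + A_l at height z + l for each z ∈ B ∖ {0}, and (A₀ + δ) ∪ A_l, of size at least
-- σ − |A*|, at height l. These pieces lie at pairwise different heights, so nσ ≤ |2A| + |A*|.
-- Together with 2|A*| ≤ σ and τ < 3(1 − 1/n), all three inequalities follow by arithmetic.

open import Defs
open import Data.Nat as ℕ using (ℕ; zero; suc; NonZero; _+_; _*_; _∸_; _≤_; _<_; z≤n; s≤s)
import Data.Nat.Properties as ℕP
open import Data.Integer as ℤ using (ℤ)
import Data.Integer.Properties as ℤP
open import Data.Fin using (Fin)
open import Data.Product using (_×_; _,_; proj₁; proj₂; ∃)
open import Data.Sum using (inj₁; inj₂)
open import Data.List using (List; []; _∷_; _++_; length; map; filter; deduplicate; concatMap)
import Data.List.Properties as LP
open import Data.List.Membership.Propositional using (_∈_; find)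
open import Data.List.Membership.Propositional.Properties
  using (∈-filter⁺; ∈-filter⁻; ∈-map⁺; ∈-map⁻; ∈-++⁻; ∈-concatMap⁻; ∈-cartesianProductWith⁺; deduplicate-∈⇔)
import Data.List.Membership.DecPropositional as DecMembership
open import Data.List.Relation.Unary.Any as Any using (here; there)
open import Data.List.Relation.Unary.All as All using ([])
open import Data.List.Relation.Unary.AllPairs using ([]; _∷_)
open import Data.List.Relation.Unary.Unique.Propositional using (Unique)
import Data.List.Relation.Unary.Unique.Propositional.Properties as Unique
import Data.List.Relation.Unary.Unique.DecPropositional.Properties as DecUnique
open import Data.List.Relation.Binary.Subset.Propositional using (_⊆_)
open import Data.List.Relation.Binary.Disjoint.Propositional using (Disjoint)
open import Data.Rational as ℚ using (ℚ)
import Data.Rational.Properties as ℚP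
open import Data.Rational.Unnormalised as ℚᵘ using (ℚᵘ; mkℚᵘ; *≡*; *≤*)
import Data.Rational.Unnormalised.Properties as ℚᵘP
import Data.Nat.Solver as ℕ-Solver
import Data.Integer.Solver as ℤ-Solver
import Data.Rational.Solver as ℚ-Solver
open import Algebra.Structures using (IsGroup; IsAbelianGroup)
open import Algebra.Bundles using (Group; AbelianGroup)
import Algebra.Properties.Group as GroupProperties
open import Function using (_∘_; id)
open import Function.Bundles using (Equivalence)
open import Relation.Binary.Definitions using (DecidableEquality)
open import Relation.Binary.PropositionalEquality
  using (_≡_; refl; sym; trans; cong; cong₂; subst; subst₂; module ≡-Reasoning)
open import Relation.Nullary using (¬_; yes; no; ¬?)
open import Relation.Nullary.Negation using (contradiction)
open import Relation.Unary using (Pred; Decidable)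
open import Relation.Unary.Properties using (∁?)

module _ {a p} {X : Set a} {P : Pred X p} (P? : Decidable P) where

  length-filter+length-filter-∁ : ∀ xs → length (filter P? xs) + length (filter (∁? P?) xs) ≡ length xs
  length-filter+length-filter-∁ [] = refl
  length-filter+length-filter-∁ (x ∷ xs) with P? x
  ... | yes _ = cong suc (length-filter+length-filter-∁ xs)
  ... | no  _ = trans (ℕP.+-suc _ _) (cong suc (length-filter+length-filter-∁ xs))

module _ {a} {X : Set a} (_≟_ : DecidableEquality X) where

  Unique-⊆⇒length≤ : ∀ {xs ys : List X} → Unique xs → xs ⊆ ys → length xs ≤ length ys
  Unique-⊆⇒length≤ {[]} _ _ = z≤n
  Unique-⊆⇒length≤ {x ∷ xs} {ys} (x∉xs ∷ !xs) x∷xs⊆ys = begin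
    suc (length xs)                         ≤⟨ s≤s (Unique-⊆⇒length≤ !xs xs⊆ys∖x) ⟩
    suc (length (filter (¬? ∘ (_≟ x)) ys))  ≤⟨ LP.filter-notAll (¬? ∘ (_≟ x)) ys x∈ys ⟩
    length ys                               ∎
    where
    open ℕP.≤-Reasoning
    x∈ys : Any.Any (λ y → ¬ ¬ (y ≡ x)) ys
    x∈ys = Any.map (λ x≡y y≢x → y≢x (sym x≡y)) (x∷xs⊆ys (here refl))
    xs⊆ys∖x : xs ⊆ filter (¬? ∘ (_≟ x)) ys
    xs⊆ys∖x y∈xs = ∈-filter⁺ (¬? ∘ (_≟ x)) (x∷xs⊆ys (there y∈xs)) (λ y≡x → All.lookup x∉xs y∈xs (sym y≡x))

  Unique⇒length≤card : ∀ {xs ys : List X} → Unique xs → xs ⊆ ys → length xs ≤ length (deduplicate _≟_ ys)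
  Unique⇒length≤card !xs xs⊆ys = Unique-⊆⇒length≤ !xs (Equivalence.to (deduplicate-∈⇔ _≟_) ∘ xs⊆ys)

  ∈⇒0<card : ∀ {x} {ys : List X} → x ∈ ys → 0 < length (deduplicate _≟_ ys)
  ∈⇒0<card x∈ys = Unique⇒length≤card ([] ∷ []) λ { (here refl) → x∈ys }

  length≤1+length-filter-≢ : ∀ c {xs : List X} → Unique xs → length xs ≤ suc (length (filter (¬? ∘ (_≟ c)) xs))
  length≤1+length-filter-≢ c {xs} !xs = begin
    length xs                                                      ≡⟨ length-filter+length-filter-∁ (_≟ c) xs ⟨
    length (filter (_≟ c) xs) + length (filter (¬? ∘ (_≟ c)) xs)   ≤⟨ ℕP.+-monoˡ-≤ _ at-most-one ⟩
    suc (length (filter (¬? ∘ (_≟ c)) xs))                         ∎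
    where
    open ℕP.≤-Reasoning
    at-most-one : length (filter (_≟ c) xs) ≤ 1
    at-most-one = Unique-⊆⇒length≤ {ys = c ∷ []} (Unique.filter⁺ (_≟ c) !xs)
                    (λ y∈ → here (proj₂ (∈-filter⁻ (_≟ c) {xs = xs} y∈)))

module _ {a b} {X : Set a} {Y : Set b} (_≟_ : DecidableEquality Y) where

  Unique-image⇒length≤card : ∀ {f : X → Y} {xs ys} → (∀ {u v} → f u ≡ f v → u ≡ v) → Unique xs
    → (∀ {u} → u ∈ xs → f u ∈ ys) → length xs ≤ length (deduplicate _≟_ ys)
  Unique-image⇒length≤card {f} {xs} {ys} f-injective !xs f[xs]⊆ys = begin
    length xs                    ≡⟨ LP.length-map f xs ⟨
    length (map f xs)            ≤⟨ Unique⇒length≤card _≟_ (Unique.map⁺ f-injective !xs) image⊆ys ⟩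
    length (deduplicate _≟_ ys)  ∎
    where
    open ℕP.≤-Reasoning
    image⊆ys : map f xs ⊆ ys
    image⊆ys fu∈ with ∈-map⁻ f fu∈
    ... | u , u∈xs , refl = f[xs]⊆ys u∈xs

module _ {a b} {X : Set a} {Y : Set b} (f : Y → List X) where

  ∈-concatMap⁻′ : ∀ {u zs} → u ∈ concatMap f zs → ∃ λ z → z ∈ zs × u ∈ f z
  ∈-concatMap⁻′ = find ∘ ∈-concatMap⁻ f

  length-concatMap-const : ∀ k → (∀ z → length (f z) ≡ k) → ∀ zs → length (concatMap f zs) ≡ length zs * k
  length-concatMap-const k len-f [] = refl
  length-concatMap-const k len-f (z ∷ zs) =
    trans (LP.length-++ (f z)) (cong₂ _+_ (len-f z) (length-concatMap-const k len-f zs))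

module _ {a b k} {X : Set a} {Y : Set b} {K : Set k} (key : X → K) {f : Y → List X} (g : Y → K) where

  concatMap-Unique : (∀ {z z'} → g z ≡ g z' → z ≡ z') → (∀ z → Unique (f z))
    → ∀ {zs} → (∀ {z u} → z ∈ zs → u ∈ f z → key u ≡ g z) → Unique zs → Unique (concatMap f zs)
  concatMap-Unique g-injective !f {[]} key-f [] = []
  concatMap-Unique g-injective !f {z ∷ zs} key-f (z∉zs ∷ !zs) =
    Unique.++⁺ (!f z) (concatMap-Unique g-injective !f (key-f ∘ there) !zs) disjoint
    where
    disjoint : Disjoint (f z) (concatMap f zs)
    disjoint (u∈fz , u∈rest) with ∈-concatMap⁻′ f u∈rest
    ... | z' , z'∈zs , u∈fz' =
      All.lookup z∉zs z'∈zs (g-injective (trans (sym (key-f (here refl) u∈fz)) (key-f (there z'∈zs) u∈fz')))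

module _ {a} {X : Set a} where

  ordered-keys⇒Disjoint : (key : X → ℤ) {xs ys : List X}
    → (∀ {u v} → u ∈ xs → v ∈ ys → key u ℤ.< key v) → Disjoint xs ys
  ordered-keys⇒Disjoint key below (u∈xs , u∈ys) = ℤP.<-irrefl refl (below u∈xs u∈ys)

  firstOr : X → List X → X
  firstOr d []      = d
  firstOr _ (x ∷ _) = x

  firstOr-∈ : ∀ {d x xs} → x ∈ xs → firstOr d xs ∈ xs
  firstOr-∈ {xs = _ ∷ _} _ = here refl

s+x<3a : ∀ {a k s x} → suc k * (2 * x) ≤ s + x → s * suc k < 3 * a * k → s + x < 3 * a
s+x<3a {a} {k} {s} {x} 2nx≤s+x sn<3ak = ℕP.*-cancelˡ-< (2 * k + 1) (s + x) (3 * a) (begin-strict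
  (2 * k + 1) * (s + x)              ≡⟨ ℕP.*-distribˡ-+ (2 * k + 1) s x ⟩
  (2 * k + 1) * s + (2 * k + 1) * x  ≤⟨ ℕP.+-monoʳ-≤ ((2 * k + 1) * s) [2k+1]x≤s ⟩
  (2 * k + 1) * s + s                ≡⟨ solve 2 (λ k s → (con 2 :* k :+ con 1) :* s :+ s := con 2 :* (s :* (con 1 :+ k))) refl k s ⟩
  2 * (s * suc k)                    <⟨ ℕP.*-monoʳ-< 2 sn<3ak ⟩
  2 * (3 * a * k)                    ≤⟨ ℕP.m≤m+n (2 * (3 * a * k)) (3 * a) ⟩
  2 * (3 * a * k) + 3 * a            ≡⟨ solve 2 (λ a k → con 2 :* (con 3 :* a :* k) :+ con 3 :* a := (con 2 :* k :+ con 1) :* (con 3 :* a)) refl a k ⟩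
  (2 * k + 1) * (3 * a)              ∎)
  where
  open ℕP.≤-Reasoning
  open ℕ-Solver.+-*-Solver
  [2k+1]x≤s : (2 * k + 1) * x ≤ s
  [2k+1]x≤s = ℕP.+-cancelʳ-≤ x ((2 * k + 1) * x) s (begin
    (2 * k + 1) * x + x  ≡⟨ solve 2 (λ k x → (con 2 :* k :+ con 1) :* x :+ x := (con 1 :+ k) :* (con 2 :* x)) refl k x ⟩
    suc k * (2 * x)      ≤⟨ 2nx≤s+x ⟩
    s + x                ∎)

σ<3a∸s×s<3a∸2x : ∀ {a n s x σ} .{{_ : NonZero n}} → n * σ ≤ s + x → 2 * x ≤ σ → s * n + 3 * a < 3 * a * n
             → σ < 3 * a ∸ s × s < 3 * a ∸ 2 * x
σ<3a∸s×s<3a∸2x {a} {n@(suc k)} {s} {x} {σ} nσ≤s+x 2x≤σ sn+3a<3an =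
  ℕP.m+n≤o⇒m≤o∸n (suc σ) (below-3a (σ + s) σ-bound) , ℕP.m+n≤o⇒m≤o∸n (suc s) (below-3a (s + 2 * x) x-bound)
  where
  open ℕP.≤-Reasoning
  open ℕ-Solver.+-*-Solver
  sn<3ak : s * n < 3 * a * k
  sn<3ak = ℕP.+-cancelʳ-< (3 * a) (s * n) (3 * a * k) (begin-strict
    s * n + 3 * a      <⟨ sn+3a<3an ⟩
    3 * a * n          ≡⟨ solve 2 (λ a k → con 3 :* a :* (con 1 :+ k) := con 3 :* a :* k :+ con 3 :* a) refl a k ⟩
    3 * a * k + 3 * a  ∎)
  2nx≤s+x : n * (2 * x) ≤ s + x
  2nx≤s+x = ℕP.≤-trans (ℕP.*-monoʳ-≤ n 2x≤σ) nσ≤s+x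
  below-3a : ∀ y → n * y ≤ s * n + (s + x) → y < 3 * a
  below-3a y ny≤ = ℕP.*-cancelˡ-< n y (3 * a) (begin-strict
    n * y              ≤⟨ ny≤ ⟩
    s * n + (s + x)    <⟨ ℕP.+-mono-<-≤ sn<3ak (ℕP.<⇒≤ (s+x<3a {a} {k} {s} {x} 2nx≤s+x sn<3ak)) ⟩
    3 * a * k + 3 * a  ≡⟨ solve 2 (λ a k → con 3 :* a :* k :+ con 3 :* a := (con 1 :+ k) :* (con 3 :* a)) refl a k ⟩
    n * (3 * a)        ∎)
  σ-bound : n * (σ + s) ≤ s * n + (s + x)
  σ-bound = begin
    n * (σ + s)      ≡⟨ ℕP.*-distribˡ-+ n σ s ⟩
    n * σ + n * s    ≤⟨ ℕP.+-monoˡ-≤ (n * s) nσ≤s+x ⟩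
    s + x + n * s    ≡⟨ solve 3 (λ n s x → s :+ x :+ n :* s := s :* n :+ (s :+ x)) refl n s x ⟩
    s * n + (s + x)  ∎
  x-bound : n * (s + 2 * x) ≤ s * n + (s + x)
  x-bound = begin
    n * (s + 2 * x)      ≡⟨ ℕP.*-distribˡ-+ n s (2 * x) ⟩
    n * s + n * (2 * x)  ≤⟨ ℕP.+-monoʳ-≤ (n * s) 2nx≤s+x ⟩
    n * s + (s + x)      ≡⟨ cong (_+ (s + x)) (ℕP.*-comm n s) ⟩
    s * n + (s + x)      ∎

private
  ι : ℕ → ℚᵘ
  ι u = mkℚᵘ (ℤ.+ u) 0

  toℚᵘ-nat : ∀ u → ℚ.toℚᵘ (nat u) ℚᵘ.≃ ι u
  toℚᵘ-nat u = ℚP.toℚᵘ-fromℚᵘ (ι u)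

nat-+ : ∀ u v → nat (u + v) ≡ nat u ℚ.+ nat v
nat-+ u v = ℚP.toℚᵘ-injective (begin
  ℚ.toℚᵘ (nat (u + v))                 ≈⟨ toℚᵘ-nat (u + v) ⟩
  ι (u + v)                             ≈⟨ *≡* (trans (cong (ℤ._* ℤ.+ 1) (ℤP.pos-+ u v))
                                            (solve 2 (λ u v → (u :+ v) :* con (ℤ.+ 1) := (u :* con (ℤ.+ 1) :+ v :* con (ℤ.+ 1)) :* con (ℤ.+ 1))
                                                   refl (ℤ.+ u) (ℤ.+ v))) ⟩
  ι u ℚᵘ.+ ι v                          ≈⟨ ℚᵘP.+-cong (toℚᵘ-nat u) (toℚᵘ-nat v) ⟨
  ℚ.toℚᵘ (nat u) ℚᵘ.+ ℚ.toℚᵘ (nat v)    ≈⟨ ℚP.toℚᵘ-homo-+ (nat u) (nat v) ⟨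
  ℚ.toℚᵘ (nat u ℚ.+ nat v)             ∎)
  where
  open ℚᵘP.≃-Reasoning
  open ℤ-Solver.+-*-Solver

nat-* : ∀ u v → nat (u * v) ≡ nat u ℚ.* nat v
nat-* u v = ℚP.toℚᵘ-injective (begin
  ℚ.toℚᵘ (nat (u * v))                 ≈⟨ toℚᵘ-nat (u * v) ⟩
  ι (u * v)                             ≈⟨ *≡* (cong (ℤ._* ℤ.+ 1) (ℤP.pos-* u v)) ⟩
  ι u ℚᵘ.* ι v                          ≈⟨ ℚᵘP.*-cong (toℚᵘ-nat u) (toℚᵘ-nat v) ⟨
  ℚ.toℚᵘ (nat u) ℚᵘ.* ℚ.toℚᵘ (nat v)    ≈⟨ ℚP.toℚᵘ-homo-* (nat u) (nat v) ⟨
  ℚ.toℚᵘ (nat u ℚ.* nat v)             ∎)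
  where open ℚᵘP.≃-Reasoning

ratio-*-nat : ∀ p q .{{_ : NonZero q}} → ratio p q ℚ.* nat q ≡ nat p
ratio-*-nat p q@(suc q-1) = ℚP.toℚᵘ-injective (begin
  ℚ.toℚᵘ (ratio p q ℚ.* nat q)               ≈⟨ ℚP.toℚᵘ-homo-* (ratio p q) (nat q) ⟩
  ℚ.toℚᵘ (ratio p q) ℚᵘ.* ℚ.toℚᵘ (nat q)     ≈⟨ ℚᵘP.*-cong (ℚP.toℚᵘ-fromℚᵘ (mkℚᵘ (ℤ.+ p) q-1)) (toℚᵘ-nat q) ⟩
  mkℚᵘ (ℤ.+ p) q-1 ℚᵘ.* ι q                    ≈⟨ *≡* (trans (ℤP.*-identityʳ _) (cong (λ d → ℤ.+ p ℤ.* ℤ.+ d) (sym (ℕP.*-identityʳ q)))) ⟩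
  ι p                                        ≈⟨ toℚᵘ-nat p ⟨
  ℚ.toℚᵘ (nat p)                             ∎)
  where open ℚᵘP.≃-Reasoning

nat-mono-≤ : ∀ {u v} → u ≤ v → nat u ℚ.≤ nat v
nat-mono-≤ {u} {v} u≤v = ℚP.toℚᵘ-cancel-≤ (begin
  ℚ.toℚᵘ (nat u)  ≃⟨ toℚᵘ-nat u ⟩
  ι u             ≤⟨ *≤* (subst₂ ℤ._≤_ (sym (ℤP.*-identityʳ (ℤ.+ u))) (sym (ℤP.*-identityʳ (ℤ.+ v))) (ℤ.+≤+ u≤v)) ⟩
  ι v             ≃⟨ toℚᵘ-nat v ⟨
  ℚ.toℚᵘ (nat v)  ∎)
  where open ℚᵘP.≤-Reasoning

nat-cancel-< : ∀ {u v} → nat u ℚ.< nat v → u < v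
nat-cancel-< {u} {v} nat-u<nat-v with u ℕ.<? v
... | yes u<v = u<v
... | no  u≮v = contradiction (ℚP.<-≤-trans nat-u<nat-v (nat-mono-≤ (ℕP.≮⇒≥ u≮v))) (ℚP.<-irrefl refl)

nat-pos : ∀ u .{{_ : NonZero u}} → ℚ.Positive (nat u)
nat-pos u = ℚP.normalize-pos u 1

ratio-nonNeg : ∀ p q → ℚ.NonNegative (ratio p q)
ratio-nonNeg p zero    = _
ratio-nonNeg p (suc q) = ℚP.normalize-nonNeg p (suc q)

module _ where
  open ℚ-Solver.+-*-Solver using (_:+_; _:*_; _:-_; _:=_; con; solve)

  <3[1-r]⇒+3r<3 : ∀ {t r} → t ℚ.< nat 3 ℚ.* (nat 1 ℚ.- r) → t ℚ.+ nat 3 ℚ.* r ℚ.< nat 3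
  <3[1-r]⇒+3r<3 {t} {r} t<3[1-r] = subst (t ℚ.+ nat 3 ℚ.* r ℚ.<_)
    (solve 1 (λ r → con (nat 3) :* (con (nat 1) :- r) :+ con (nat 3) :* r := con (nat 3)) refl r)
    (ℚP.+-monoˡ-< (nat 3 ℚ.* r) t<3[1-r])

  clear-denominators : ∀ a n s .{{_ : NonZero a}} .{{_ : NonZero n}}
    → ratio s a ℚ.+ nat 3 ℚ.* ratio 1 n ℚ.< nat 3 → s * n + 3 * a < 3 * a * n
  clear-denominators a n s t+3r<3 = nat-cancel-< (begin-strict
    nat (s * n + 3 * a)                          ≡⟨ lhs ⟨
    (t ℚ.+ nat 3 ℚ.* r) ℚ.* (nat a ℚ.* nat n)    <⟨ ℚP.*-monoˡ-<-pos (nat a ℚ.* nat n) {{an-pos}} t+3r<3 ⟩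
    nat 3 ℚ.* (nat a ℚ.* nat n)                  ≡⟨ rhs ⟩
    nat (3 * a * n)                              ∎)
    where
    open ℚP.≤-Reasoning
    t r : ℚ
    t = ratio s a
    r = ratio 1 n
    an-pos : ℚ.Positive (nat a ℚ.* nat n)
    an-pos = ℚP.pos*pos⇒pos (nat a) {{nat-pos a}} (nat n) {{nat-pos n}}
    lhs : (t ℚ.+ nat 3 ℚ.* r) ℚ.* (nat a ℚ.* nat n) ≡ nat (s * n + 3 * a)
    lhs = begin-equality
      (t ℚ.+ nat 3 ℚ.* r) ℚ.* (nat a ℚ.* nat n)
        ≡⟨ solve 4 (λ t r A N → (t :+ con (nat 3) :* r) :* (A :* N) := t :* A :* N :+ con (nat 3) :* A :* (r :* N))
                 refl t r (nat a) (nat n) ⟩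
      t ℚ.* nat a ℚ.* nat n ℚ.+ nat 3 ℚ.* nat a ℚ.* (r ℚ.* nat n)
        ≡⟨ cong₂ (λ u v → u ℚ.* nat n ℚ.+ nat 3 ℚ.* nat a ℚ.* v) (ratio-*-nat s a) (ratio-*-nat 1 n) ⟩
      nat s ℚ.* nat n ℚ.+ nat 3 ℚ.* nat a ℚ.* nat 1  ≡⟨ cong (nat s ℚ.* nat n ℚ.+_) (ℚP.*-identityʳ (nat 3 ℚ.* nat a)) ⟩
      nat s ℚ.* nat n ℚ.+ nat 3 ℚ.* nat a            ≡⟨ cong₂ ℚ._+_ (nat-* s n) (nat-* 3 a) ⟨
      nat (s * n) ℚ.+ nat (3 * a)                    ≡⟨ nat-+ (s * n) (3 * a) ⟨
      nat (s * n + 3 * a)                            ∎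
    rhs : nat 3 ℚ.* (nat a ℚ.* nat n) ≡ nat (3 * a * n)
    rhs = begin-equality
      nat 3 ℚ.* (nat a ℚ.* nat n)  ≡⟨ ℚP.*-assoc (nat 3) (nat a) (nat n) ⟨
      nat 3 ℚ.* nat a ℚ.* nat n    ≡⟨ cong (ℚ._* nat n) (nat-* 3 a) ⟨
      nat (3 * a) ℚ.* nat n        ≡⟨ nat-* (3 * a) n ⟨
      nat (3 * a * n)              ∎

  3σ<[3-τ][τa+x] : ∀ a n s x σ .{{_ : NonZero a}} .{{_ : NonZero n}} → 0 < s + x → n * σ ≤ s + x
    → ratio s a ℚ.+ nat 3 ℚ.* ratio 1 n ℚ.< nat 3
    → nat 3 ℚ.* nat σ ℚ.< (nat 3 ℚ.- ratio s a) ℚ.* (ratio s a ℚ.* nat a ℚ.+ nat x)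
  3σ<[3-τ][τa+x] a n s x σ 0<s+x nσ≤s+x t+3r<3 = begin-strict
    nat 3 ℚ.* nat σ                          ≡⟨ scale ⟩
    (nat 3 ℚ.* r) ℚ.* nat (n * σ)            ≤⟨ ℚP.*-monoˡ-≤-nonNeg (nat 3 ℚ.* r) {{3r-nonNeg}} (nat-mono-≤ nσ≤s+x) ⟩
    (nat 3 ℚ.* r) ℚ.* nat (s + x)            <⟨ ℚP.*-monoˡ-<-pos (nat (s + x)) {{nat-pos (s + x) {{ℕ.>-nonZero 0<s+x}}}} 3r<3-t ⟩
    (nat 3 ℚ.- t) ℚ.* nat (s + x)            ≡⟨ cong ((nat 3 ℚ.- t) ℚ.*_) (trans (nat-+ s x) (cong (ℚ._+ nat x) (sym (ratio-*-nat s a)))) ⟩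
    (nat 3 ℚ.- t) ℚ.* (t ℚ.* nat a ℚ.+ nat x) ∎
    where
    open ℚP.≤-Reasoning
    t r : ℚ
    t = ratio s a
    r = ratio 1 n
    3r-nonNeg : ℚ.NonNegative (nat 3 ℚ.* r)
    3r-nonNeg = ℚP.nonNeg*nonNeg⇒nonNeg (nat 3) {{ℚP.normalize-nonNeg 3 1}} r {{ratio-nonNeg 1 n}}
    3r<3-t : nat 3 ℚ.* r ℚ.< nat 3 ℚ.- t
    3r<3-t = subst (ℚ._< nat 3 ℚ.- t) (solve 2 (λ t R → t :+ R :- t := R) refl t (nat 3 ℚ.* r))
               (ℚP.+-monoˡ-< (ℚ.- t) t+3r<3)
    scale : nat 3 ℚ.* nat σ ≡ (nat 3 ℚ.* r) ℚ.* nat (n * σ)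
    scale = begin-equality
      nat 3 ℚ.* nat σ                        ≡⟨ ℚP.*-identityʳ (nat 3 ℚ.* nat σ) ⟨
      nat 3 ℚ.* nat σ ℚ.* nat 1              ≡⟨ cong (nat 3 ℚ.* nat σ ℚ.*_) (ratio-*-nat 1 n) ⟨
      nat 3 ℚ.* nat σ ℚ.* (r ℚ.* nat n)      ≡⟨ solve 4 (λ T S r N → T :* S :* (r :* N) := (T :* r) :* (N :* S)) refl (nat 3) (nat σ) r (nat n) ⟩
      (nat 3 ℚ.* r) ℚ.* (nat n ℚ.* nat σ)    ≡⟨ cong (nat 3 ℚ.* r ℚ.*_) (nat-* n σ) ⟨
      (nat 3 ℚ.* r) ℚ.* nat (n * σ)          ∎

module ℤ+ = GroupProperties (AbelianGroup.group ℤP.+-0-abelianGroup)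

module DirectSum {m : ℕ} {_·_ : Fin m → Fin m → Fin m} {e inv} (isGroup : IsGroup _≡_ _·_ e inv) where

  private
    H-group : Group _ _
    H-group = record { isGroup = isGroup }
    module H = GroupProperties H-group

  infixl 6 _⊕_ _⊖_

  _⊕_ _⊖_ : G m → G m → G m
  _⊕_ = addG _·_
  _⊖_ = subG _·_ inv

  ⊕-identityˡ : ∀ u → (ℤ.0ℤ , e) ⊕ u ≡ u
  ⊕-identityˡ (z , h) = cong₂ _,_ (ℤP.+-identityˡ z) (IsGroup.identityˡ isGroup h)

  ⊕-cancelˡ : ∀ c {u v} → c ⊕ u ≡ c ⊕ v → u ≡ v
  ⊕-cancelˡ (z , h) {u} {v} eq = cong₂ _,_ (ℤ+.∙-cancelˡ z (proj₁ u) (proj₁ v) (cong proj₁ eq))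
                                          (H.∙-cancelˡ h (proj₂ u) (proj₂ v) (cong proj₂ eq))

  u⊕d⊖d≡u : ∀ u d → u ⊕ d ⊖ d ≡ u
  u⊕d⊖d≡u (z , h) (y , g) = cong₂ _,_ (ℤ+.//-rightDividesʳ y z) (H.//-rightDividesʳ g h)

  u⊖d⊕d≡u : ∀ u d → u ⊖ d ⊕ d ≡ u
  u⊖d⊕d≡u (z , h) (y , g) = cong₂ _,_ (ℤ+.//-rightDividesˡ y z) (H.//-rightDividesˡ g h)

  ⊕-cancelʳ : ∀ d {u v} → u ⊕ d ≡ v ⊕ d → u ≡ v
  ⊕-cancelʳ d {u} {v} eq = trans (sym (u⊕d⊖d≡u u d)) (trans (cong (_⊖ d) eq) (u⊕d⊖d≡u v d))

  ⊖-cancelʳ : ∀ d {u v} → u ⊖ d ≡ v ⊖ d → u ≡ v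
  ⊖-cancelʳ d {u} {v} eq = trans (sym (u⊖d⊕d≡u u d)) (trans (cong (_⊕ d) eq) (u⊖d⊕d≡u v d))

module _ {m : ℕ} where

  open DecMembership (_≟G_ {m}) using (_∈?_)

  ∈-card⁻ : ∀ {u} {xs : List (G m)} → u ∈ deduplicate _≟G_ xs → u ∈ xs
  ∈-card⁻ = Equivalence.from (deduplicate-∈⇔ _≟G_)

  card-inter≤ˡ : ∀ (X Y : List (G m)) → card (inter X Y) ≤ card X
  card-inter≤ˡ X Y = Unique⇒length≤card _≟G_ (DecUnique.deduplicate-! _≟G_ (inter X Y))
                       (proj₁ ∘ ∈-filter⁻ (_∈? Y) {xs = X} ∘ ∈-card⁻)

  card-inter≤ʳ : ∀ (X Y : List (G m)) → card (inter X Y) ≤ card Y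
  card-inter≤ʳ X Y = Unique⇒length≤card _≟G_ (DecUnique.deduplicate-! _≟G_ (inter X Y))
                       (proj₂ ∘ ∈-filter⁻ (_∈? Y) {xs = X} ∘ ∈-card⁻)

  card-shift≤ : ∀ {_·_ : Fin m → Fin m → Fin m} {e inv} → IsGroup _≡_ _·_ e inv
    → ∀ (Y : List (G m)) δ → card (shift _·_ inv Y δ) ≤ card Y
  card-shift≤ {_·_} {inv = inv} isGroup Y δ =
    Unique-image⇒length≤card _≟G_ (⊕-cancelʳ δ) (DecUnique.deduplicate-! _≟G_ _) back
    where
    open DirectSum isGroup
    back : ∀ {u} → u ∈ deduplicate _≟G_ (shift _·_ inv Y δ) → u ⊕ δ ∈ Y
    back u∈ with ∈-map⁻ (_⊖ δ) (∈-card⁻ u∈)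
    ... | y , y∈Y , refl = subst (_∈ Y) (sym (u⊖d⊕d≡u y δ)) y∈Y

module SumsetBound {m : ℕ} {_·_ : Fin m → Fin m → Fin m} {e inv} (isGroup : IsGroup _≡_ _·_ e inv)
  (A : List (G m)) (l : ℤ) (δ : G m)
  (A-above-0 : ∀ a → a ∈ A → ℤ.0ℤ ℤ.≤ proj₁ a)
  (A-below-l : ∀ a → a ∈ A → proj₁ a ℤ.≤ l)
  (0∈A₀ : (ℤ.0ℤ , e) ∈ fiber A ℤ.0ℤ)
  (δ∈Aₗ : δ ∈ fiber A l) where

  open DirectSum isGroup
  open DecMembership (_≟G_ {m}) using (_∈?_)

  A₀ Aₗ : List (G m)
  A₀ = deduplicate _≟G_ (fiber A ℤ.0ℤ)
  Aₗ = deduplicate _≟G_ (fiber A l)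

  B B∖l B∖0 : List ℤ
  B   = deduplicate ℤP._≟_ (support A)
  B∖l = filter (¬? ∘ (ℤP._≟ l)) B
  B∖0 = filter (¬? ∘ (ℤP._≟ ℤ.0ℤ)) B

  ∈-fiber⁻ : ∀ {u z} → u ∈ fiber A z → u ∈ A × proj₁ u ≡ z
  ∈-fiber⁻ {z = z} = ∈-filter⁻ (λ a → proj₁ a ℤP.≟ z)

  ∈B⁻ : ∀ {z} → z ∈ B → ∃ λ a → a ∈ A × z ≡ proj₁ a
  ∈B⁻ = ∈-map⁻ proj₁ ∘ Equivalence.from (deduplicate-∈⇔ ℤP._≟_)

  ∈B∖⁻ : ∀ c {z} → z ∈ filter (¬? ∘ (ℤP._≟ c)) B → z ∈ B × ¬ (z ≡ c)
  ∈B∖⁻ c = ∈-filter⁻ (¬? ∘ (ℤP._≟ c))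

  B-above-0 : ∀ {z} → z ∈ B → ℤ.0ℤ ℤ.≤ z
  B-above-0 z∈B with ∈B⁻ z∈B
  ... | a , a∈A , refl = A-above-0 a a∈A

  B-below-l : ∀ {z} → z ∈ B → z ℤ.≤ l
  B-below-l z∈B with ∈B⁻ z∈B
  ... | a , a∈A , refl = A-below-l a a∈A

  -- The default (z , e) is never used: representatives are only taken for z ∈ B.
  representative : ℤ → G m
  representative z = firstOr (z , e) (fiber A z)

  representative-∈ : ∀ {z} → z ∈ B → representative z ∈ fiber A z
  representative-∈ z∈B with ∈B⁻ z∈B
  ... | a , a∈A , refl = firstOr-∈ (∈-filter⁺ (λ b → proj₁ b ℤP.≟ proj₁ a) a∈A refl)

  representative∈A : ∀ {z} → z ∈ B → representative z ∈ A
  representative∈A = proj₁ ∘ ∈-fiber⁻ ∘ representative-∈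

  sum∈2A : ∀ {u v} → u ∈ A → v ∈ A → u ⊕ v ∈ sumset _·_ A
  sum∈2A = ∈-cartesianProductWith⁺ (addG _·_)

  lower upper : ℤ → List (G m)
  lower z = map (_⊕ representative z) A₀
  upper z = map (representative z ⊕_) Aₗ

  A₀⊕δ Aₗ∖A₀⊕δ middle witnesses : List (G m)
  A₀⊕δ      = map (_⊕ δ) A₀
  Aₗ∖A₀⊕δ   = filter (∁? (_∈? A₀⊕δ)) Aₗ
  middle    = A₀⊕δ ++ Aₗ∖A₀⊕δ
  witnesses = concatMap lower B∖l ++ (middle ++ concatMap upper B∖0)

  A₀-Unique : Unique A₀
  A₀-Unique = DecUnique.deduplicate-! _≟G_ (fiber A ℤ.0ℤ)

  Aₗ-Unique : Unique Aₗ
  Aₗ-Unique = DecUnique.deduplicate-! _≟G_ (fiber A l)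

  ∈A₀⁻ : ∀ {u} → u ∈ A₀ → u ∈ A × proj₁ u ≡ ℤ.0ℤ
  ∈A₀⁻ = ∈-fiber⁻ ∘ ∈-card⁻

  ∈Aₗ⁻ : ∀ {u} → u ∈ Aₗ → u ∈ A × proj₁ u ≡ l
  ∈Aₗ⁻ = ∈-fiber⁻ ∘ ∈-card⁻

  lower-key : ∀ {z u} → z ∈ B → u ∈ lower z → proj₁ u ≡ z
  lower-key z∈B u∈ with ∈-map⁻ (_⊕ representative _) u∈
  ... | a , a∈A₀ , refl = trans (cong₂ ℤ._+_ (proj₂ (∈A₀⁻ a∈A₀)) (proj₂ (∈-fiber⁻ (representative-∈ z∈B))))
                                (ℤP.+-identityˡ _)

  upper-key : ∀ {z u} → z ∈ B → u ∈ upper z → proj₁ u ≡ z ℤ.+ l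
  upper-key z∈B u∈ with ∈-map⁻ (representative _ ⊕_) u∈
  ... | b , b∈Aₗ , refl = cong₂ ℤ._+_ (proj₂ (∈-fiber⁻ (representative-∈ z∈B))) (proj₂ (∈Aₗ⁻ b∈Aₗ))

  middle-key : ∀ {u} → u ∈ middle → proj₁ u ≡ l
  middle-key u∈ with ∈-++⁻ A₀⊕δ u∈
  ... | inj₂ u∈Aₗ∖ = proj₂ (∈Aₗ⁻ (proj₁ (∈-filter⁻ (∁? (_∈? A₀⊕δ)) u∈Aₗ∖)))
  ... | inj₁ u∈A₀⊕δ with ∈-map⁻ (_⊕ δ) u∈A₀⊕δ
  ...   | a , a∈A₀ , refl = trans (cong₂ ℤ._+_ (proj₂ (∈A₀⁻ a∈A₀)) (proj₂ (∈-fiber⁻ δ∈Aₗ))) (ℤP.+-identityˡ l)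

  lower-below-l : ∀ {u} → u ∈ concatMap lower B∖l → proj₁ u ℤ.< l
  lower-below-l u∈ with ∈-concatMap⁻′ lower u∈
  ... | z , z∈B∖l , u∈lower with ∈B∖⁻ l z∈B∖l
  ...   | z∈B , z≢l = subst (ℤ._< l) (sym (lower-key z∈B u∈lower)) (ℤP.≤∧≢⇒< (B-below-l z∈B) z≢l)

  upper-above-l : ∀ {u} → u ∈ concatMap upper B∖0 → l ℤ.< proj₁ u
  upper-above-l u∈ with ∈-concatMap⁻′ upper u∈
  ... | z , z∈B∖0 , u∈upper with ∈B∖⁻ ℤ.0ℤ z∈B∖0
  ...   | z∈B , z≢0 = subst (l ℤ.<_) (sym (upper-key z∈B u∈upper))
                        (subst (ℤ._< z ℤ.+ l) (ℤP.+-identityˡ l) (ℤP.+-monoˡ-< l (ℤP.≤∧≢⇒< (B-above-0 z∈B) (z≢0 ∘ sym))))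

  witnesses-Unique : Unique witnesses
  witnesses-Unique =
    Unique.++⁺ lower-Unique (Unique.++⁺ middle-Unique upper-Unique middle-upper-Disjoint) lower-rest-Disjoint
    where
    B∖-Unique : ∀ c → Unique (filter (¬? ∘ (ℤP._≟ c)) B)
    B∖-Unique c = Unique.filter⁺ (¬? ∘ (ℤP._≟ c)) (DecUnique.deduplicate-! ℤP._≟_ (support A))
    lower-Unique : Unique (concatMap lower B∖l)
    lower-Unique = concatMap-Unique proj₁ id id
      (λ z → Unique.map⁺ (⊕-cancelʳ (representative z)) A₀-Unique)
      (lower-key ∘ proj₁ ∘ ∈B∖⁻ l) (B∖-Unique l)
    upper-Unique : Unique (concatMap upper B∖0)
    upper-Unique = concatMap-Unique proj₁ (ℤ._+ l) (ℤ+.∙-cancelʳ l _ _)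
      (λ z → Unique.map⁺ (⊕-cancelˡ (representative z)) Aₗ-Unique)
      (upper-key ∘ proj₁ ∘ ∈B∖⁻ ℤ.0ℤ) (B∖-Unique ℤ.0ℤ)
    middle-Unique : Unique middle
    middle-Unique = Unique.++⁺ (Unique.map⁺ (⊕-cancelʳ δ) A₀-Unique) (Unique.filter⁺ (∁? (_∈? A₀⊕δ)) Aₗ-Unique)
      (λ (u∈A₀⊕δ , u∈Aₗ∖) → proj₂ (∈-filter⁻ (∁? (_∈? A₀⊕δ)) {xs = Aₗ} u∈Aₗ∖) u∈A₀⊕δ)
    middle-upper-Disjoint : Disjoint middle (concatMap upper B∖0)
    middle-upper-Disjoint = ordered-keys⇒Disjoint proj₁ λ u∈ v∈ →
      subst (ℤ._< _) (sym (middle-key u∈)) (upper-above-l v∈)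
    lower-rest-Disjoint : Disjoint (concatMap lower B∖l) (middle ++ concatMap upper B∖0)
    lower-rest-Disjoint = ordered-keys⇒Disjoint proj₁ λ u∈ v∈ → ℤP.<-≤-trans (lower-below-l u∈) (at-least-l v∈)
      where
      at-least-l : ∀ {v} → v ∈ middle ++ concatMap upper B∖0 → l ℤ.≤ proj₁ v
      at-least-l v∈ with ∈-++⁻ middle v∈
      ... | inj₁ v∈middle = ℤP.≤-reflexive (sym (middle-key v∈middle))
      ... | inj₂ v∈upper  = ℤP.<⇒≤ (upper-above-l v∈upper)

  witnesses⊆2A : ∀ {u} → u ∈ witnesses → u ∈ sumset _·_ A
  witnesses⊆2A u∈ with ∈-++⁻ (concatMap lower B∖l) u∈
  ... | inj₁ u∈lowers with ∈-concatMap⁻′ lower u∈lowers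
  ...   | z , z∈B∖l , u∈lower with ∈-map⁻ (_⊕ representative z) u∈lower
  ...     | a , a∈A₀ , refl = sum∈2A (proj₁ (∈A₀⁻ a∈A₀)) (representative∈A (proj₁ (∈B∖⁻ l z∈B∖l)))
  witnesses⊆2A u∈ | inj₂ u∈rest with ∈-++⁻ middle u∈rest
  ... | inj₂ u∈uppers with ∈-concatMap⁻′ upper u∈uppers
  ...   | z , z∈B∖0 , u∈upper with ∈-map⁻ (representative z ⊕_) u∈upper
  ...     | b , b∈Aₗ , refl = sum∈2A (representative∈A (proj₁ (∈B∖⁻ ℤ.0ℤ z∈B∖0))) (proj₁ (∈Aₗ⁻ b∈Aₗ))
  witnesses⊆2A u∈ | inj₂ u∈rest | inj₁ u∈middle with ∈-++⁻ A₀⊕δ u∈middle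
  ... | inj₁ u∈A₀⊕δ with ∈-map⁻ (_⊕ δ) u∈A₀⊕δ
  ...   | a , a∈A₀ , refl = sum∈2A (proj₁ (∈A₀⁻ a∈A₀)) (proj₁ (∈-fiber⁻ δ∈Aₗ))
  witnesses⊆2A {u} u∈ | inj₂ u∈rest | inj₁ u∈middle | inj₂ u∈Aₗ∖ =
    subst (_∈ sumset _·_ A) (⊕-identityˡ u)
      (sum∈2A (proj₁ (∈-fiber⁻ 0∈A₀)) (proj₁ (∈Aₗ⁻ (proj₁ (∈-filter⁻ (∁? (_∈? A₀⊕δ)) {xs = Aₗ} u∈Aₗ∖)))))

  length-witnesses : length witnesses ≡ length B∖l * length A₀ + ((length A₀ + length Aₗ∖A₀⊕δ) + length B∖0 * length Aₗ)
  length-witnesses = begin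
    length witnesses                                                   ≡⟨ LP.length-++ (concatMap lower B∖l) ⟩
    length (concatMap lower B∖l) + length (middle ++ concatMap upper B∖0) ≡⟨ cong (length (concatMap lower B∖l) +_) (LP.length-++ middle) ⟩
    length (concatMap lower B∖l) + (length middle + length (concatMap upper B∖0))
      ≡⟨ cong₂ _+_ (length-concatMap-const lower _ (λ _ → LP.length-map _ A₀) B∖l)
                   (cong₂ _+_ (trans (LP.length-++ A₀⊕δ) (cong (_+ length Aₗ∖A₀⊕δ) (LP.length-map _ A₀)))
                              (length-concatMap-const upper _ (λ _ → LP.length-map _ Aₗ) B∖0)) ⟩
    length B∖l * length A₀ + ((length A₀ + length Aₗ∖A₀⊕δ) + length B∖0 * length Aₗ) ∎
    where open ≡-Reasoning

  A* : List (G m)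
  A* = inter (fiber A ℤ.0ℤ) (shift _·_ inv (fiber A l) δ)

  Aₗ∩A₀⊕δ≤card-A* : length (filter (_∈? A₀⊕δ) Aₗ) ≤ card A*
  Aₗ∩A₀⊕δ≤card-A* = Unique-image⇒length≤card _≟G_ (⊖-cancelʳ δ) (Unique.filter⁺ (_∈? A₀⊕δ) Aₗ-Unique) into-A*
    where
    into-A* : ∀ {u} → u ∈ filter (_∈? A₀⊕δ) Aₗ → u ⊖ δ ∈ A*
    into-A* u∈ with ∈-filter⁻ (_∈? A₀⊕δ) {xs = Aₗ} u∈
    ... | u∈Aₗ , u∈A₀⊕δ with ∈-map⁻ (_⊕ δ) u∈A₀⊕δ
    ...   | a , a∈A₀ , refl = ∈-filter⁺ (_∈? shift _·_ inv (fiber A l) δ)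
              (subst (_∈ fiber A ℤ.0ℤ) (sym (u⊕d⊖d≡u a δ)) (∈-card⁻ a∈A₀))
              (∈-map⁺ (_⊖ δ) (∈-card⁻ u∈Aₗ))

  sumset-lower-bound : length B * (length A₀ + length Aₗ) ≤ card (sumset _·_ A) + card A*
  sumset-lower-bound = begin
    n * (p + q)                                  ≡⟨ ℕP.*-distribˡ-+ n p q ⟩
    n * p + n * q                                ≤⟨ ℕP.+-mono-≤ (ℕP.*-monoˡ-≤ p (n≤1+ l)) (ℕP.*-monoˡ-≤ q (n≤1+ ℤ.0ℤ)) ⟩
    (p + length B∖l * p) + (q + length B∖0 * q)  ≤⟨ ℕP.+-monoʳ-≤ (p + length B∖l * p) (ℕP.+-monoˡ-≤ (length B∖0 * q) q≤x+r) ⟩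
    (p + length B∖l * p) + ((x + r) + length B∖0 * q)
      ≡⟨ solve 6 (λ p q x r b₁ b₂ → (p :+ b₁ :* p) :+ ((x :+ r) :+ b₂ :* q) := b₁ :* p :+ ((p :+ r) :+ b₂ :* q) :+ x) refl
               p q x r (length B∖l) (length B∖0) ⟩
    (length B∖l * p + ((p + r) + length B∖0 * q)) + x ≡⟨ cong (_+ x) length-witnesses ⟨
    length witnesses + x                         ≤⟨ ℕP.+-monoˡ-≤ x (Unique⇒length≤card _≟G_ witnesses-Unique witnesses⊆2A) ⟩
    card (sumset _·_ A) + x                      ∎
    where
    open ℕP.≤-Reasoning
    open ℕ-Solver.+-*-Solver
    n p q x r : ℕ
    n = length B
    p = length A₀
    q = length Aₗ
    x = card A*
    r = length Aₗ∖A₀⊕δ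
    n≤1+ : ∀ c → n ≤ suc (length (filter (¬? ∘ (ℤP._≟ c)) B))
    n≤1+ c = length≤1+length-filter-≢ ℤP._≟_ c (DecUnique.deduplicate-! ℤP._≟_ (support A))
    q≤x+r : q ≤ x + r
    q≤x+r = begin
      q                                              ≡⟨ length-filter+length-filter-∁ (_∈? A₀⊕δ) Aₗ ⟨
      length (filter (_∈? A₀⊕δ) Aₗ) + r              ≤⟨ ℕP.+-monoˡ-≤ r Aₗ∩A₀⊕δ≤card-A* ⟩
      x + r                                          ∎

  2*card-A*≤σ : 2 * card A* ≤ length A₀ + length Aₗ
  2*card-A*≤σ = ℕP.+-mono-≤ (card-inter≤ˡ (fiber A ℤ.0ℤ) _)
    (subst (_≤ length Aₗ) (sym (ℕP.+-identityʳ (card A*)))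
      (ℕP.≤-trans (card-inter≤ʳ (fiber A ℤ.0ℤ) _) (card-shift≤ isGroup (fiber A l) δ)))

corollary4 : (m : ℕ) (_·_ : Fin m → Fin m → Fin m) (e : Fin m) (inv : Fin m → Fin m)
    → IsAbelianGroup _≡_ _·_ e inv
    → (A : List (G m)) (l : ℤ) (δ : G m)
    → (∀ a → a ∈ A → ℤ.0ℤ ℤ.≤ proj₁ a)
    → (∀ a → a ∈ A → proj₁ a ℤ.≤ l)
    → ℤ.0ℤ ℤ.< l
    → (ℤ.0ℤ , e) ∈ fiber A ℤ.0ℤ
    → δ ∈ fiber A l
    → let n = cardℤ (support A)
          σ = card (fiber A ℤ.0ℤ) ℕ.+ card (fiber A l)
          Astar = inter (fiber A ℤ.0ℤ) (shift _·_ inv (fiber A l) δ)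
          τ = ratio (card (sumset _·_ A)) (card A)
      in τ ℚ.< nat 3 ℚ.* (nat 1 ℚ.- ratio 1 n)
      → (nat 3 ℚ.* nat σ ℚ.< (nat 3 ℚ.- τ) ℚ.* (τ ℚ.* nat (card A) ℚ.+ nat (card Astar)))
        × (σ ℕ.< 3 ℕ.* card A ℕ.∸ card (sumset _·_ A))
        × (card (sumset _·_ A) ℕ.< 3 ℕ.* card A ℕ.∸ 2 ℕ.* card Astar)
-- The counting argument does not need l > 0.
corollary4 m _·_ e inv isAG A l δ A-above-0 A-below-l _ 0∈A₀ δ∈Aₗ τ<3[1-1/n] =
  3σ<[3-τ][τa+x] a n s x σ 0<s+x sumset-lower-bound τ+3/n<3 ,
  σ<3a∸s×s<3a∸2x {a} sumset-lower-bound 2*card-A*≤σ (clear-denominators a n s τ+3/n<3)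
  where
  open SumsetBound (IsAbelianGroup.isGroup isAG) A l δ A-above-0 A-below-l 0∈A₀ δ∈Aₗ
  a n s x σ : ℕ
  a = card A
  n = length B
  s = card (sumset _·_ A)
  x = card A*
  σ = length A₀ + length Aₗ
  0∈A : (ℤ.0ℤ , e) ∈ A
  0∈A = proj₁ (∈-fiber⁻ 0∈A₀)
  instance
    a≢0 : NonZero a
    a≢0 = ℕ.>-nonZero (∈⇒0<card _≟G_ 0∈A)
    n≢0 : NonZero n
    n≢0 = ℕ.>-nonZero (∈⇒0<card ℤP._≟_ (∈-map⁺ proj₁ 0∈A))
  0<s+x : 0 < s + x
  0<s+x = ℕP.<-≤-trans (ℕP.<-≤-trans (∈⇒0<card _≟G_ 0∈A₀) (ℕP.m≤m+n _ _))
                       (ℕP.≤-trans (ℕP.m≤n*m σ n) sumset-lower-bound)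
  τ+3/n<3 : ratio s a ℚ.+ nat 3 ℚ.* ratio 1 n ℚ.< nat 3
  τ+3/n<3 = <3[1-r]⇒+3r<3 {r = ratio 1 n} τ<3[1-1/n]
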